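{- If a $(v,k,\lambda)$-BIBD admits a $0$-ULSE $\ell$-colouring, then $k(v-1)(v-k)$ is a perfect square.
   Context: For positive integers $v,k,\lambda$ with $2\le k<v$, a $(v,k,\lambda)$-BIBD is a pair $(V,\mathcal{B})$ where $V$ is a set of $v$ points and $\mathcal{B}$ is a collection of $k$-element subsets of $V$ (blocks) such that every pair of distinct points lies in exactly $\lambda$ blocks. An $\ell$-colouring is a surjective map from $V$ onto a set of $\ell$ colours. A $0$-ULSE $\ell$-colouring is an $\ell$-colouring such that $(\ell-1)$ divides $k$ and in every block exactly one colour does not appear, while each of the other $\ell-1$ colours appears exactly $\frac{k}{\ell-1}$ times in that block. -}

module Defs where

open import Data.Nat using (ℕ; _∸_; _≤_; _<_; _*_)
open import Data.Nat.Divisibility using (_∣_)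
open import Data.Fin using (Fin)
open import Data.Fin.Subset using (Subset; _∈_; _∉_; _∩_; ∣_∣)
open import Data.Vec using (tabulate)
open import Data.Bool using (Bool; true; false)
open import Data.List using (List; filter; length)
open import Data.List.Relation.Unary.All using (All)
open import Data.Product using (Σ; ∃; _×_; ∃-syntax)
open import Relation.Binary.PropositionalEquality using (_≡_; _≢_)
open import Relation.Nullary using (¬_; Dec; yes; no)
open import Relation.Nullary.Decidable using (⌊_⌋)
open import Data.Fin.Properties using (_≟_)
open import Data.Bool.Properties using () renaming (_≟_ to _≟ᵇ_)
open import Data.Vec using (lookup)

-- Points are Fin v; a block is a subset of Fin v; the blocks form a
-- list (a multiset: repeated blocks allowed).

_∈ᵇ_ : ∀ {v} → Fin v → Subset v → Bool
i ∈ᵇ b = lookup b i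

bothIn : ∀ {v} → Fin v → Fin v → Subset v → Bool
bothIn i j b with i ∈ᵇ b | j ∈ᵇ b
... | true | true = true
... | _    | _    = false

pairCount : ∀ {v} → List (Subset v) → Fin v → Fin v → ℕ
pairCount B i j = length (filter (λ b → bothIn i j b ≟ᵇ true) B)

record IsBIBD (v k λ' : ℕ) (B : List (Subset v)) : Set where
  field
    two≤k   : 2 ≤ k
    k<v     : k < v
    pos-λ   : 1 ≤ λ'
    blockSize : All (λ b → ∣ b ∣ ≡ k) B
    balanced  : ∀ (i j : Fin v) → i ≢ j → pairCount B i j ≡ λ'

colourClass : ∀ {v ℓ} → (Fin v → Fin ℓ) → Fin ℓ → Subset v
colourClass χ c = tabulate (λ i → ⌊ χ i ≟ c ⌋)

occ : ∀ {v ℓ} → (Fin v → Fin ℓ) → Subset v → Fin ℓ → ℕ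
occ χ b c = ∣ b ∩ colourClass χ c ∣

Surjective : ∀ {v ℓ} → (Fin v → Fin ℓ) → Set
Surjective {v} {ℓ} χ = ∀ (c : Fin ℓ) → ∃[ i ] χ i ≡ c

record Is0ULSE (v k ℓ : ℕ) (B : List (Subset v)) (χ : Fin v → Fin ℓ) : Set where
  field
    surj  : Surjective χ
    div   : (ℓ ∸ 1) ∣ k
    perBlock : All (λ b → ∃[ c₀ ] (occ χ b c₀ ≡ 0 ×
                    (∀ c → c ≢ c₀ → occ χ b c ≡ _∣_.quotient div))) B

IsPerfectSquare : ℕ → Set
IsPerfectSquare n = ∃[ m ] m * m ≡ n

module Submission where

-- Let C be a colour class, of size n. Every block meets C in 0 or q = k/(ℓ − 1) points, so
-- with S = ∑_B |B ∩ C| the two double counts of (block, i, j) with i ≠ j in the block and i ∈ C,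
-- according as j ∈ C or j is arbitrary, read λ n(n − 1) = (q − 1) S and λ n(v − 1) = (k − 1) S.
-- Hence (n − 1)(k − 1) = (q − 1)(v − 1): all colour classes have the same size n, so v = ℓ n.
-- Substituting k = q(ℓ − 1) and v = ℓ n turns the relation into (ℓ − 1)(v − k) = q(v − 1), whence
-- k (v − 1)(v − k) = (q (v − 1))².

open import Defs
open import Data.Bool using (Bool; true; false; not; _∧_)
open import Data.Fin using (Fin; zero; suc; fromℕ<)
open import Data.Fin.Properties using (_≟_)
open import Data.Fin.Subset using (Subset; _∩_; ∣_∣)
open import Data.Fin.Subset.Properties using (x∈p⇒∣p-x∣<∣p∣)
open import Data.List using (List; length)
import Data.List as List
open import Data.List.Membership.Propositional.Properties using (∈-lookup)
open import Data.List.Relation.Unary.All as All using (All)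
open import Data.Nat using (ℕ; zero; suc; _+_; _*_; _∸_; _≤_; z≤n; s≤s; >-nonZero)
open import Data.Nat.Properties
  using (+-*-semiring; +-identityʳ; +-comm; *-identityˡ; *-identityʳ; *-zeroʳ; *-comm;
         *-assoc; *-distribʳ-+; *-distribʳ-∸; m+n∸n≡m; m+[n∸m]≡n;
         *-cancelˡ-≡; *-cancelʳ-≡; +-cancelˡ-≡; m*n≢0; ≤-trans; ≤-reflexive; <⇒≤)
open import Data.Nat.Divisibility using (_∣_)
open import Data.Nat.Tactic.RingSolver using (solve-∀)
open import Data.Product using (_,_; _×_; ∃-syntax)
open import Data.Sum using (_⊎_; inj₁; inj₂)
open import Data.Vec using ([]; _∷_; lookup)
open import Data.Vec.Properties using (lookup∘tabulate; lookup⇒[]=)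
open import Function using (_∘_)
open import Relation.Binary.PropositionalEquality
open import Relation.Nullary using (does; yes; no; contradiction)
open import Relation.Nullary.Decidable using (⌊_⌋; dec-true; isYes≗does)
open import Algebra.Properties.Semiring.Sum +-*-semiring
  using (sum; sum-syntax; sum-cong-≗; sum-replicate-zero; ∑-distrib-+; ∑-comm;
         *-distribˡ-sum; *-distribʳ-sum)

⟦_⟧ : Bool → ℕ
⟦ true  ⟧ = 1
⟦ false ⟧ = 0

⟦⟧-idem : ∀ x → ⟦ x ⟧ * ⟦ x ⟧ ≡ ⟦ x ⟧
⟦⟧-idem true  = refl
⟦⟧-idem false = refl

⟦∧⟧ : ∀ x y → ⟦ x ∧ y ⟧ ≡ ⟦ x ⟧ * ⟦ y ⟧
⟦∧⟧ true  y = sym (+-identityʳ ⟦ y ⟧)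
⟦∧⟧ false y = refl

δ δᶜ : ∀ {n} → Fin n → Fin n → ℕ
δ  i j = ⟦ does (i ≟ j) ⟧
δᶜ i j = ⟦ not (does (i ≟ j)) ⟧

δ+δᶜ≡1 : ∀ {n} (i j : Fin n) → δ i j + δᶜ i j ≡ 1
δ+δᶜ≡1 i j with does (i ≟ j)
... | true  = refl
... | false = refl

∑-const : ∀ n c → ∑[ i < n ] c ≡ n * c
∑-const zero    c = refl
∑-const (suc n) c = cong (c +_) (∑-const n c)

∑-δ : ∀ {n} (i : Fin n) (g : Fin n → ℕ) → ∑[ j < n ] (δ i j * g j) ≡ g i
∑-δ {suc n} zero    g = trans (cong (g zero + 0 +_) (sum-replicate-zero n))
                              (trans (+-identityʳ _) (+-identityʳ _))
∑-δ {suc n} (suc i) g = ∑-δ i (g ∘ suc)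

-- Stands in for (∑ f)(∑ g) − ∑ f g, avoiding subtraction in ℕ.
offDiag : ∀ {n} → (Fin n → ℕ) → (Fin n → ℕ) → ℕ
offDiag {n} f g = ∑[ i < n ] ∑[ j < n ] (δᶜ i j * (f i * g j))

offDiag-+-diag : ∀ {n} (f g h : Fin n → ℕ) → (∀ i → f i * g i ≡ h i) →
  offDiag f g + sum h ≡ sum f * sum g
offDiag-+-diag {n} f g h fg≗h = sym (begin
  sum f * sum g                                  ≡⟨ *-distribʳ-sum (sum g) f ⟩
  ∑[ i < n ] (f i * sum g)                       ≡⟨ sum-cong-≗ (λ i → *-distribˡ-sum (f i) g) ⟩
  ∑[ i < n ] ∑[ j < n ] fg i j                   ≡⟨ sum-cong-≗ (λ i → sum-cong-≗ (split i)) ⟩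
  ∑[ i < n ] ∑[ j < n ] (δᶜ i j * fg i j + δ i j * fg i j)
    ≡⟨ sum-cong-≗ (λ i → ∑-distrib-+ (λ j → δᶜ i j * fg i j) (λ j → δ i j * fg i j)) ⟩
  ∑[ i < n ] (∑[ j < n ] (δᶜ i j * fg i j) + ∑[ j < n ] (δ i j * fg i j))
    ≡⟨ ∑-distrib-+ (λ i → ∑[ j < n ] (δᶜ i j * fg i j)) (λ i → ∑[ j < n ] (δ i j * fg i j)) ⟩
  offDiag f g + ∑[ i < n ] ∑[ j < n ] (δ i j * fg i j)
    ≡⟨ cong (offDiag f g +_) (sum-cong-≗ (λ i → trans (∑-δ i (fg i)) (fg≗h i))) ⟩
  offDiag f g + sum h                            ∎)
  where
  open ≡-Reasoning
  fg : Fin n → Fin n → ℕ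
  fg i j = f i * g j
  split : ∀ i j → fg i j ≡ δᶜ i j * fg i j + δ i j * fg i j
  split i j = begin
    fg i j                          ≡⟨ sym (*-identityˡ (fg i j)) ⟩
    1 * fg i j                      ≡⟨ cong (_* fg i j) (trans (sym (δ+δᶜ≡1 i j)) (+-comm (δ i j) _)) ⟩
    (δᶜ i j + δ i j) * fg i j       ≡⟨ *-distribʳ-+ (fg i j) (δᶜ i j) (δ i j) ⟩
    δᶜ i j * fg i j + δ i j * fg i j ∎

indicator : ∀ {n} → Subset n → Fin n → ℕ
indicator p i = ⟦ lookup p i ⟧

∣p∣≡∑indicator : ∀ {n} (p : Subset n) → ∣ p ∣ ≡ sum (indicator p)
∣p∣≡∑indicator []          = refl
∣p∣≡∑indicator (true  ∷ p) = cong suc (∣p∣≡∑indicator p)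
∣p∣≡∑indicator (false ∷ p) = ∣p∣≡∑indicator p

∣p∩q∣≡∑indicator*indicator : ∀ {n} (p q : Subset n) →
  ∣ p ∩ q ∣ ≡ ∑[ i < n ] (indicator p i * indicator q i)
∣p∩q∣≡∑indicator*indicator p q = trans (∣p∣≡∑indicator (p ∩ q)) (sum-cong-≗ (indicator-∩ p q))
  where
  indicator-∩ : ∀ {n} (p q : Subset n) i → indicator (p ∩ q) i ≡ indicator p i * indicator q i
  indicator-∩ (x ∷ p) (y ∷ q) zero    = ⟦∧⟧ x y
  indicator-∩ (x ∷ p) (y ∷ q) (suc i) = indicator-∩ p q i

module PairCounting {v r λ' : ℕ} (𝓑 : Fin r → Subset v)
  (balanced : ∀ i j → i ≢ j → ∑[ t < r ] (indicator (𝓑 t) i * indicator (𝓑 t) j) ≡ λ')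
  where

  blockSum : Fin r → (Fin v → ℕ) → ℕ
  blockSum t f = ∑[ i < v ] (indicator (𝓑 t) i * f i)

  ∑-incidence*δᶜ : ∀ i j → ∑[ t < r ] (indicator (𝓑 t) i * indicator (𝓑 t) j) * δᶜ i j ≡ λ' * δᶜ i j
  ∑-incidence*δᶜ i j with i ≟ j
  ... | yes refl = trans (*-zeroʳ (∑[ t < r ] (indicator (𝓑 t) i * indicator (𝓑 t) i))) (sym (*-zeroʳ λ'))
  ... | no  i≢j  = cong (_* 1) (balanced i j i≢j)

  ∑-offDiag-blockwise : ∀ (f g : Fin v → ℕ) →
    ∑[ t < r ] offDiag (λ i → indicator (𝓑 t) i * f i) (λ j → indicator (𝓑 t) j * g j)
      ≡ λ' * offDiag f g
  ∑-offDiag-blockwise f g = begin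
    ∑[ t < r ] ∑[ i < v ] ∑[ j < v ] term t i j   ≡⟨ ∑-comm (λ t i → ∑[ j < v ] term t i j) ⟩
    ∑[ i < v ] ∑[ t < r ] ∑[ j < v ] term t i j   ≡⟨ sum-cong-≗ (λ i → ∑-comm (λ t j → term t i j)) ⟩
    ∑[ i < v ] ∑[ j < v ] ∑[ t < r ] term t i j   ≡⟨ sum-cong-≗ (λ i → sum-cong-≗ (∑-term i)) ⟩
    ∑[ i < v ] ∑[ j < v ] (λ' * (δᶜ i j * fg i j))
      ≡⟨ sum-cong-≗ (λ i → sym (*-distribˡ-sum λ' (λ j → δᶜ i j * fg i j))) ⟩
    ∑[ i < v ] (λ' * ∑[ j < v ] (δᶜ i j * fg i j))
      ≡⟨ sym (*-distribˡ-sum λ' (λ i → ∑[ j < v ] (δᶜ i j * fg i j))) ⟩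
    λ' * offDiag f g                             ∎
    where
    open ≡-Reasoning
    β : Fin r → Fin v → ℕ
    β t = indicator (𝓑 t)
    fg : Fin v → Fin v → ℕ
    fg i j = f i * g j
    term : Fin r → Fin v → Fin v → ℕ
    term t i j = δᶜ i j * ((β t i * f i) * (β t j * g j))
    regroup : ∀ d x y z w → d * ((x * y) * (z * w)) ≡ (x * z) * d * (y * w)
    regroup = solve-∀
    ∑-term : ∀ i j → ∑[ t < r ] term t i j ≡ λ' * (δᶜ i j * fg i j)
    ∑-term i j = begin
      ∑[ t < r ] term t i j
        ≡⟨ sum-cong-≗ (λ t → regroup (δᶜ i j) (β t i) (f i) (β t j) (g j)) ⟩
      ∑[ t < r ] ((β t i * β t j) * δᶜ i j * fg i j)
        ≡⟨ sym (*-distribʳ-sum (fg i j) (λ t → (β t i * β t j) * δᶜ i j)) ⟩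
      ∑[ t < r ] ((β t i * β t j) * δᶜ i j) * fg i j
        ≡⟨ cong (_* fg i j) (sym (*-distribʳ-sum (δᶜ i j) (λ t → β t i * β t j))) ⟩
      ∑[ t < r ] (β t i * β t j) * δᶜ i j * fg i j
        ≡⟨ cong (_* fg i j) (∑-incidence*δᶜ i j) ⟩
      λ' * δᶜ i j * fg i j
        ≡⟨ *-assoc λ' (δᶜ i j) (fg i j) ⟩
      λ' * (δᶜ i j * fg i j) ∎

  ∑-blockSum*blockSum : ∀ (f g h : Fin v → ℕ) → (∀ i → f i * g i ≡ h i) →
    ∑[ t < r ] (blockSum t f * blockSum t g) ≡ λ' * offDiag f g + ∑[ t < r ] blockSum t h
  ∑-blockSum*blockSum f g h fg≗h = begin
    ∑[ t < r ] (blockSum t f * blockSum t g)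
      ≡⟨ sum-cong-≗ (λ t → sym (offDiag-+-diag (βf t) (βg t) (βh t) (diag t))) ⟩
    ∑[ t < r ] (offDiag (βf t) (βg t) + blockSum t h)
      ≡⟨ ∑-distrib-+ (λ t → offDiag (βf t) (βg t)) (λ t → blockSum t h) ⟩
    ∑[ t < r ] offDiag (βf t) (βg t) + ∑[ t < r ] blockSum t h
      ≡⟨ cong (_+ ∑[ t < r ] blockSum t h) (∑-offDiag-blockwise f g) ⟩
    λ' * offDiag f g + ∑[ t < r ] blockSum t h ∎
    where
    open ≡-Reasoning
    βf βg βh : Fin r → Fin v → ℕ
    βf t i = indicator (𝓑 t) i * f i
    βg t i = indicator (𝓑 t) i * g i
    βh t i = indicator (𝓑 t) i * h i
    regroup : ∀ x y z → (x * y) * (x * z) ≡ (x * x) * (y * z)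
    regroup = solve-∀
    diag : ∀ t i → βf t i * βg t i ≡ βh t i
    diag t i = begin
      βf t i * βg t i                                     ≡⟨ regroup (indicator (𝓑 t) i) (f i) (g i) ⟩
      indicator (𝓑 t) i * indicator (𝓑 t) i * (f i * g i) ≡⟨ cong₂ _*_ (⟦⟧-idem (lookup (𝓑 t) i)) (fg≗h i) ⟩
      βh t i                                              ∎

pairCount≡∑ : ∀ {v} (B : List (Subset v)) i j →
  pairCount B i j ≡ ∑[ t < length B ] (indicator (List.lookup B t) i * indicator (List.lookup B t) j)
pairCount≡∑ List.[] i j = refl
pairCount≡∑ (b List.∷ B) i j with lookup b i | lookup b j
... | true  | true  = cong suc (pairCount≡∑ B i j)
... | true  | false = pairCount≡∑ B i j
... | false | _     = pairCount≡∑ B i j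

m+n≡o*n⇒m≡[o∸1]*n : ∀ {m n} o → m + n ≡ o * n → m ≡ (o ∸ 1) * n
m+n≡o*n⇒m≡[o∸1]*n {m} {n} o eq = begin
  m              ≡⟨ sym (m+n∸n≡m m n) ⟩
  m + n ∸ n      ≡⟨ cong (_∸ n) eq ⟩
  o * n ∸ n      ≡⟨ cong (o * n ∸_) (sym (*-identityˡ n)) ⟩
  o * n ∸ 1 * n  ≡⟨ sym (*-distribʳ-∸ n o 1) ⟩
  (o ∸ 1) * n    ∎
  where open ≡-Reasoning

double-count-relation : ∀ λ' n q k v {S X Y} → 1 ≤ λ' → 1 ≤ n →
  λ' * X + S ≡ q * S → X + n ≡ n * n → λ' * Y + S ≡ k * S → Y + n ≡ n * v →
  (n ∸ 1) * (k ∸ 1) ≡ (q ∸ 1) * (v ∸ 1)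
double-count-relation λ' n q k v {S} {X} {Y} 1≤λ' 1≤n eqX X+n eqY Y+n =
  *-cancelˡ-≡ _ _ (λ' * n) {{m*n≢0 λ' n {{>-nonZero 1≤λ'}} {{>-nonZero 1≤n}}}} (begin
    λ' * n * ((n ∸ 1) * (k ∸ 1))   ≡⟨ reorder λ' n (n ∸ 1) (k ∸ 1) ⟩
    λ' * ((n ∸ 1) * n) * (k ∸ 1)   ≡⟨ cong (λ x → λ' * x * (k ∸ 1)) (sym X≡) ⟩
    λ' * X * (k ∸ 1)               ≡⟨ cong (_* (k ∸ 1)) λ'X≡ ⟩
    (q ∸ 1) * S * (k ∸ 1)          ≡⟨ swap (q ∸ 1) S (k ∸ 1) ⟩
    (q ∸ 1) * ((k ∸ 1) * S)        ≡⟨ cong ((q ∸ 1) *_) (sym λ'Y≡) ⟩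
    (q ∸ 1) * (λ' * Y)             ≡⟨ cong (λ y → (q ∸ 1) * (λ' * y)) Y≡ ⟩
    (q ∸ 1) * (λ' * ((v ∸ 1) * n)) ≡⟨ reorder′ (q ∸ 1) λ' (v ∸ 1) n ⟩
    λ' * n * ((q ∸ 1) * (v ∸ 1))   ∎)
  where
  open ≡-Reasoning
  λ'X≡ : λ' * X ≡ (q ∸ 1) * S
  λ'X≡ = m+n≡o*n⇒m≡[o∸1]*n q eqX
  X≡ : X ≡ (n ∸ 1) * n
  X≡ = m+n≡o*n⇒m≡[o∸1]*n n X+n
  λ'Y≡ : λ' * Y ≡ (k ∸ 1) * S
  λ'Y≡ = m+n≡o*n⇒m≡[o∸1]*n k eqY
  Y≡ : Y ≡ (v ∸ 1) * n
  Y≡ = m+n≡o*n⇒m≡[o∸1]*n v (trans Y+n (*-comm n v))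
  reorder : ∀ a b c d → a * b * (c * d) ≡ a * (c * b) * d
  reorder = solve-∀
  swap : ∀ a b c → a * b * c ≡ a * (c * b)
  swap = solve-∀
  reorder′ : ∀ a b c d → a * (b * (c * d)) ≡ b * d * (a * c)
  reorder′ = solve-∀

Meets0Or : ∀ {v} → ℕ → List (Subset v) → Subset v → Set
Meets0Or q B C = All (λ b → ∣ b ∩ C ∣ ≡ 0 ⊎ ∣ b ∩ C ∣ ≡ q) B

module _ {v k λ' : ℕ} {B : List (Subset v)} (D : IsBIBD v k λ' B) where
  open IsBIBD D
  open PairCounting (List.lookup B) (λ i j i≢j → trans (sym (pairCount≡∑ B i j)) (balanced i j i≢j))

  blockSum-indicator : ∀ t (C : Subset v) → blockSum t (indicator C) ≡ ∣ List.lookup B t ∩ C ∣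
  blockSum-indicator t C = sym (∣p∩q∣≡∑indicator*indicator (List.lookup B t) C)

  blockSum-one : ∀ t → blockSum t (λ _ → 1) ≡ k
  blockSum-one t = begin
    blockSum t (λ _ → 1)  ≡⟨ sum-cong-≗ (λ i → *-identityʳ (indicator b i)) ⟩
    sum (indicator b)     ≡⟨ sym (∣p∣≡∑indicator b) ⟩
    ∣ b ∣                 ≡⟨ All.lookup blockSize (∈-lookup t) ⟩
    k                     ∎
    where
    open ≡-Reasoning
    b = List.lookup B t

  meets0Or⇒size-relation : ∀ {q} (C : Subset v) → 1 ≤ ∣ C ∣ → Meets0Or q B C →
    (∣ C ∣ ∸ 1) * (k ∸ 1) ≡ (q ∸ 1) * (v ∸ 1)
  meets0Or⇒size-relation {q} C 1≤∣C∣ meets =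
    subst (λ n → (n ∸ 1) * (k ∸ 1) ≡ (q ∸ 1) * (v ∸ 1)) (sym ∣C∣≡n)
      (double-count-relation λ' n q k v pos-λ (subst (1 ≤_) ∣C∣≡n 1≤∣C∣) eqX X+n eqY Y+n)
    where
    f one : Fin v → ℕ
    f = indicator C
    one _ = 1
    n S : ℕ
    n = sum f
    S = ∑[ t < length B ] blockSum t f
    ∣C∣≡n : ∣ C ∣ ≡ n
    ∣C∣≡n = ∣p∣≡∑indicator C
    f-idem : ∀ i → f i * f i ≡ f i
    f-idem i = ⟦⟧-idem (lookup C i)
    blockSum-square : ∀ t → blockSum t f * blockSum t f ≡ q * blockSum t f
    blockSum-square t rewrite blockSum-indicator t C with All.lookup meets (∈-lookup t)
    ... | inj₁ ∣b∩C∣≡0 rewrite ∣b∩C∣≡0 = sym (*-zeroʳ q)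
    ... | inj₂ ∣b∩C∣≡q rewrite ∣b∩C∣≡q = refl
    eqX : λ' * offDiag f f + S ≡ q * S
    eqX = trans (sym (∑-blockSum*blockSum f f f f-idem))
                (trans (sum-cong-≗ blockSum-square) (sym (*-distribˡ-sum q (λ t → blockSum t f))))
    X+n : offDiag f f + n ≡ n * n
    X+n = offDiag-+-diag f f f f-idem
    eqY : λ' * offDiag f one + S ≡ k * S
    eqY = trans (sym (∑-blockSum*blockSum f one f (λ i → *-identityʳ (f i))))
                (trans (sum-cong-≗ (λ t → trans (cong (blockSum t f *_) (blockSum-one t)) (*-comm _ k)))
                       (sym (*-distribˡ-sum k (λ t → blockSum t f))))
    Y+n : offDiag f one + n ≡ n * v
    Y+n = trans (offDiag-+-diag f one f (λ i → *-identityʳ (f i)))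
                (cong (n *_) (trans (∑-const v 1) (*-identityʳ v)))

lookup-colourClass : ∀ {v ℓ} (χ : Fin v → Fin ℓ) c i → lookup (colourClass χ c) i ≡ does (χ i ≟ c)
lookup-colourClass χ c i = trans (lookup∘tabulate (λ i → ⌊ χ i ≟ c ⌋) i) (isYes≗does (χ i ≟ c))

∑-∣colourClass∣ : ∀ {v ℓ} (χ : Fin v → Fin ℓ) → ∑[ c < ℓ ] ∣ colourClass χ c ∣ ≡ v
∑-∣colourClass∣ {v} {ℓ} χ = begin
  ∑[ c < ℓ ] ∣ colourClass χ c ∣     ≡⟨ sum-cong-≗ (λ c → ∣p∣≡∑indicator (colourClass χ c)) ⟩
  ∑[ c < ℓ ] ∑[ i < v ] indicator (colourClass χ c) i
    ≡⟨ sum-cong-≗ (λ c → sum-cong-≗ (λ i → cong ⟦_⟧ (lookup-colourClass χ c i))) ⟩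
  ∑[ c < ℓ ] ∑[ i < v ] δ (χ i) c    ≡⟨ ∑-comm (λ c i → δ (χ i) c) ⟩
  ∑[ i < v ] ∑[ c < ℓ ] δ (χ i) c    ≡⟨ sum-cong-≗ (λ i → ∑-δ-one (χ i)) ⟩
  ∑[ i < v ] 1                       ≡⟨ trans (∑-const v 1) (*-identityʳ v) ⟩
  v                                  ∎
  where
  open ≡-Reasoning
  ∑-δ-one : ∀ x → ∑[ c < ℓ ] δ x c ≡ 1
  ∑-δ-one x = trans (sum-cong-≗ (λ c → sym (*-identityʳ (δ x c)))) (∑-δ x (λ _ → 1))

colourClass-nonempty : ∀ {v ℓ} {χ : Fin v → Fin ℓ} → Surjective χ → ∀ c → 1 ≤ ∣ colourClass χ c ∣
colourClass-nonempty {χ = χ} surj c with surj c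
... | i , χi≡c = ≤-trans (s≤s z≤n) (x∈p⇒∣p-x∣<∣p∣ i∈C)
  where
  i∈C = lookup⇒[]= i (colourClass χ c) (trans (lookup-colourClass χ c i) (dec-true (χ i ≟ c) χi≡c))

colourClass-meets0Or : ∀ {v k ℓ B χ} (U : Is0ULSE v k ℓ B χ) →
  ∀ c → Meets0Or (_∣_.quotient (Is0ULSE.div U)) B (colourClass χ c)
colourClass-meets0Or {χ = χ} U c = All.map (λ {b} → classify {b}) perBlock
  where
  open Is0ULSE U
  q = _∣_.quotient div
  classify : ∀ {b} → ∃[ c₀ ] (occ χ b c₀ ≡ 0 × (∀ c' → c' ≢ c₀ → occ χ b c' ≡ q)) →
             ∣ b ∩ colourClass χ c ∣ ≡ 0 ⊎ ∣ b ∩ colourClass χ c ∣ ≡ q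
  classify (c₀ , absent , present) with c ≟ c₀
  ... | yes refl = inj₁ absent
  ... | no  c≢c₀ = inj₂ (present c c≢c₀)

[m∸1]*[o∸1]≡[n∸1]*[o∸1]⇒m≡n : ∀ {m n o} → 2 ≤ o → 1 ≤ m → 1 ≤ n →
  (m ∸ 1) * (o ∸ 1) ≡ (n ∸ 1) * (o ∸ 1) → m ≡ n
[m∸1]*[o∸1]≡[n∸1]*[o∸1]⇒m≡n {suc m} {suc n} {suc (suc o)} (s≤s (s≤s _)) _ _ eq =
  cong suc (*-cancelʳ-≡ m n (suc o) eq)

-- Shifted variables ℓ = m + 2, n + 1, q + 1 make every truncated subtraction reduce, so that
-- expand is a ring identity: it says m(v − k) − q(v − 1) = ℓ((n − 1)(k − 1) − (q − 1)(v − 1))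
-- with the negative terms moved across.
[ℓ∸1]*[v∸k]≡q*[v∸1] : ∀ m n q → let k = suc q * suc m ; v = suc (suc m) * suc n in
  k ≤ v → n * (k ∸ 1) ≡ q * (v ∸ 1) → suc m * (v ∸ k) ≡ suc q * (v ∸ 1)
[ℓ∸1]*[v∸k]≡q*[v∸1] m n q k≤v rel = +-cancelˡ-≡ (m₊ * k + ℓ * (q * u)) _ _ (begin
  m₊ * k + ℓ * (q * u) + m₊ * (v ∸ k) ≡⟨ regroup m₊ k (ℓ * (q * u)) (v ∸ k) ⟩
  m₊ * (k + (v ∸ k)) + ℓ * (q * u)    ≡⟨ cong (λ x → m₊ * x + ℓ * (q * u)) (m+[n∸m]≡n k≤v) ⟩
  m₊ * v + ℓ * (q * u)                ≡⟨ expand m n q ⟩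
  m₊ * k + ℓ * (n * (k ∸ 1)) + q₊ * u ≡⟨ cong (λ x → m₊ * k + ℓ * x + q₊ * u) rel ⟩
  m₊ * k + ℓ * (q * u) + q₊ * u       ∎)
  where
  open ≡-Reasoning
  m₊ q₊ ℓ k v u : ℕ
  m₊ = suc m
  q₊ = suc q
  ℓ = suc m₊
  k = q₊ * m₊
  v = ℓ * suc n
  u = v ∸ 1
  regroup : ∀ c a b d → c * a + b + c * d ≡ c * (a + d) + b
  regroup = solve-∀
  expand : ∀ m n q → suc m * (suc (suc m) * suc n) + suc (suc m) * (q * (n + suc m * suc n))
    ≡ suc m * (suc q * suc m) + suc (suc m) * (n * (m + q * suc m)) + suc q * (n + suc m * suc n)
  expand = solve-∀

perfect-square : ∀ ℓ n q {k v} → 2 ≤ k → k ≤ v → k ≡ q * (ℓ ∸ 1) → ℓ * n ≡ v →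
  (n ∸ 1) * (k ∸ 1) ≡ (q ∸ 1) * (v ∸ 1) → IsPerfectSquare (k * (v ∸ 1) * (v ∸ k))
perfect-square ℓ n zero 2≤k _ refl _ _ = contradiction 2≤k λ ()
perfect-square zero n q 2≤k _ refl _ _ =
  contradiction (≤-trans 2≤k (≤-reflexive (*-zeroʳ q))) λ ()
perfect-square (suc zero) n q 2≤k _ refl _ _ =
  contradiction (≤-trans 2≤k (≤-reflexive (*-zeroʳ q))) λ ()
perfect-square ℓ zero q 2≤k k≤v _ refl _ =
  contradiction (≤-trans 2≤k (≤-trans k≤v (≤-reflexive (*-zeroʳ ℓ)))) λ ()
perfect-square (suc (suc m)) (suc n) (suc q) _ k≤v refl refl rel = suc q * (v ∸ 1) , (begin
  suc q * u * (suc q * u)         ≡⟨ cong (suc q * u *_) (sym ([ℓ∸1]*[v∸k]≡q*[v∸1] m n q k≤v rel)) ⟩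
  suc q * u * (suc m * (v ∸ k))   ≡⟨ regroup (suc q) u (suc m) (v ∸ k) ⟩
  suc q * suc m * u * (v ∸ k)     ∎)
  where
  open ≡-Reasoning
  k v u : ℕ
  k = suc q * suc m
  v = suc (suc m) * suc n
  u = v ∸ 1
  regroup : ∀ a b c d → a * b * (c * d) ≡ a * c * b * d
  regroup = solve-∀

corollary3p16 : (v k λ' ℓ : ℕ) (B : List (Subset v)) (χ : Fin v → Fin ℓ) →
    IsBIBD v k λ' B → Is0ULSE v k ℓ B χ →
    IsPerfectSquare (k * (v ∸ 1) * (v ∸ k))
corollary3p16 v k λ' ℓ B χ D U =
  perfect-square ℓ (size c₀) q two≤k (<⇒≤ k<v) (_∣_.equality div) ℓ*n≡v (relation c₀)
  where
  open IsBIBD D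
  open Is0ULSE U
  q : ℕ
  q = _∣_.quotient div
  size : Fin ℓ → ℕ
  size c = ∣ colourClass χ c ∣
  relation : ∀ c → (size c ∸ 1) * (k ∸ 1) ≡ (q ∸ 1) * (v ∸ 1)
  relation c = meets0Or⇒size-relation D (colourClass χ c)
                 (colourClass-nonempty surj c) (colourClass-meets0Or U c)
  c₀ : Fin ℓ
  c₀ = χ (fromℕ< (≤-trans (s≤s z≤n) k<v))
  same-size : ∀ c → size c ≡ size c₀
  same-size c = [m∸1]*[o∸1]≡[n∸1]*[o∸1]⇒m≡n two≤k
                  (colourClass-nonempty surj c) (colourClass-nonempty surj c₀)
                  (trans (relation c) (sym (relation c₀)))
  ℓ*n≡v : ℓ * size c₀ ≡ v
  ℓ*n≡v = trans (sym (∑-const ℓ (size c₀))) (trans (sum-cong-≗ (sym ∘ same-size)) (∑-∣colourClass∣ χ))
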